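{- Define integer sequences for $N\ge 1$ by $S_{1000}(N)=\frac{3^N-1}{2}$ and the coupled recurrences $S_{909}(1)=1$, $S_{909}(N+1)=S_{727}(N)+2S_{1000}(N)+1$ for $N\ge1$; $S_{727}(1)=1$, $S_{727}(2)=4$, $S_{727}(N+1)=S_{909}(N)+2S_{909}(N-1)+2S_{1000}(N-1)+3$ for $N\ge2$. For the Magnetic Tower of Hanoi with $N\ge1$ disks and posts pre-colored $(S,I,D)=(\mathrm{Red},\mathrm{Blue},\mathrm{Neutral})$ or $(S,I,D)=(\mathrm{Neutral},\mathrm{Red},\mathrm{Blue})$, the minimum number of moves to go from the start state to the end state is $S_{909}(N)$.
   Context: The Magnetic Tower of Hanoi (MToH): there are three posts, Source $S$, Intermediate $I$, Destination $D$, and $N$ disks of distinct sizes. Each disk has one face colored Red and the other Blue. A move takes the top disk of one post and places it on top of another post; every move flips the disk, so its up-facing color changes at each move. Size rule: a disk may never be placed on a smaller disk. Magnetic rule: like colors repel, so a disk may be placed on another disk only if the touching faces have different colors; equivalently all disks stacked on a post show the same color facing up. A post pre-colored Red (resp. Blue) only accepts disks with Red (resp. Blue) facing up; a Neutral post imposes no color restriction on its bottom disk (its effective color is determined by the disks currently on it and it is unrestricted again when empty). Start state: all $N$ disks stacked in size order on $S$ with Red facing up. End state: all $N$ disks stacked in size order on $D$ with Blue facing up. -}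

module Defs where

open import Data.Nat using (ℕ; zero; suc; _+_; _*_; _∸_; _^_; _≤_)
open import Data.Nat.DivMod using (_/_)
open import Data.Fin using (Fin) renaming (_<_ to _<ᶠ_)
open import Data.Vec using (Vec; lookup; replicate; _[_]≔_)
open import Data.Product using (_×_; _,_; proj₁; proj₂)
open import Data.Maybe using (Maybe; just; nothing)
open import Relation.Binary.PropositionalEquality using (_≡_; _≢_)

-- Integer sequences (only meaningful for N ≥ 1; value at 0 is a dummy)

S1000 : ℕ → ℕ
S1000 N = (3 ^ N ∸ 1) / 2

mutual
  S909 : ℕ → ℕ
  S909 zero = 0
  S909 (suc zero) = 1
  S909 (suc (suc n)) = S727 (suc n) + 2 * S1000 (suc n) + 1

  S727 : ℕ → ℕ
  S727 zero = 0
  S727 (suc zero) = 1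
  S727 (suc (suc zero)) = 4
  S727 (suc (suc (suc n))) =
    S909 (suc (suc n)) + 2 * S909 (suc n) + 2 * S1000 (suc n) + 3

data Post : Set where
  S I D : Post

data Color : Set where
  Red Blue : Color

flipC : Color → Color
flipC Red  = Blue
flipC Blue = Red

-- Pre-coloring of posts: just c = pre-colored c, nothing = Neutral.
PostColoring : Set
PostColoring = Post → Maybe Color

-- Disks are Fin N, ordered by size (smaller index = smaller disk).
-- Since every legal stack is in size order, a state is determined by
-- the post each disk lies on and the color facing up.
State : ℕ → Set
State N = Vec (Post × Color) N

postOf : ∀ {N} → State N → Fin N → Post
postOf s d = proj₁ (lookup s d)

colorOf : ∀ {N} → State N → Fin N → Color
colorOf s d = proj₂ (lookup s d)

record Move {N : ℕ} (pc : PostColoring) (s t : State N) : Set where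
  field
    disk     : Fin N
    target   : Post
    different : target ≢ postOf s disk
    isTop    : ∀ e → e <ᶠ disk → postOf s e ≢ postOf s disk
    sizeOK   : ∀ e → postOf s e ≡ target → disk <ᶠ e
    magnetOK : ∀ e → postOf s e ≡ target → colorOf s e ≡ flipC (colorOf s disk)
    postOK   : ∀ c → pc target ≡ just c → flipC (colorOf s disk) ≡ c
    result   : t ≡ s [ disk ]≔ (target , flipC (colorOf s disk))

data Reach {N : ℕ} (pc : PostColoring) : ℕ → State N → State N → Set where
  done : ∀ {s} → Reach pc 0 s s
  step : ∀ {k s t u} → Move pc s t → Reach pc k t u → Reach pc (suc k) s u

startState : (N : ℕ) → State N
startState N = replicate N (S , Red)

endState : (N : ℕ) → State N
endState N = replicate N (D , Blue)

MinMoves : PostColoring → ℕ → ℕ → Set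
MinMoves pc N m =
  Reach pc m (startState N) (endState N) ×
  (∀ k → Reach pc k (startState N) (endState N) → m ≤ k)

colRBN : PostColoring
colRBN S = just Red
colRBN I = just Blue
colRBN D = nothing

colNRB : PostColoring
colNRB S = nothing
colNRB I = just Red
colNRB D = just Blue

-- Induction on the number of disks, for the six colourings of the posts that
-- arise and for every pair of towers a, b at once: the least
-- number of moves from a tower at a to a tower at b is a linear form
-- cost κ a b in five sequences A, P, Q, R, T obeying a joint linear
-- recurrence. Removing the largest disk turns a play of n + 1 disks into plays
-- of n disks in which the post under the largest disk is pre-coloured, which is
-- why the six colourings suffice. The upper bound follows explicit routes of
-- tower transfers and single moves of the largest disk. The lower bound is a
-- potential argument: until the largest disk first moves, the smaller disks
-- only rearrange under it, and when it moves they must form a tower on the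
-- third post. All the resulting linear inequalities between forms are checked
-- by evaluation, using a few inequalities between the sequences that the
-- recurrence itself preserves.

module Submission where

open import Defs
open import Data.Bool using (Bool; T; _∧_; _∨_)
open import Data.Bool.ListAction using (any)
open import Data.Bool.Properties using (T-∧; T-∨; T?)
open import Data.Empty using (⊥-elim)
open import Data.Fin as Fin using (Fin; inject₁; fromℕ)
open import Data.Fin.Properties using (toℕ-inject₁; toℕ-fromℕ; toℕ<n)
open import Data.Fin.Relation.Unary.Top using (view; ‵fromℕ; ‵inject₁)
open import Data.List using (List; []; _∷_)
open import Data.List.Membership.Propositional using (_∈_)
open import Data.List.Relation.Unary.All as All using (All; []; _∷_)
open import Data.List.Relation.Unary.Any using (here; there)
open import Data.List.Relation.Unary.Any.Properties using (any⁻)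
open import Data.Maybe using (Maybe; just; nothing)
open import Data.Maybe.Properties using (just-injective) renaming (≡-dec to ≡-dec-Maybe)
open import Data.Maybe.Relation.Unary.Any as MaybeAny using (just) renaming (Any to OnJust)
open import Data.Nat using (ℕ; zero; suc; _+_; _*_; _^_; _≤_; _≥_; _≤ᵇ_; z≤n; s≤s; _≟_)
open import Data.Nat.DivMod using (_/_; m*n/n≡m)
open import Data.Nat.Properties
open import Data.Nat.Tactic.RingSolver using (solve-∀)
open import Data.Product using (_×_; _,_; proj₁; proj₂; Σ; uncurry)
open import Data.Sum using (inj₁; inj₂)
open import Data.Vec using (Vec; []; _∷_; _∷ʳ_; lookup; replicate; _[_]≔_)
open import Data.Vec.Properties using (lookup∘update; lookup∘update′; lookup-replicate; ∷ʳ-injective)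
open import Function using (_∘_; Equivalence)
open import Relation.Binary.Construct.Closure.ReflexiveTransitive using (Star; ε; _◅_)
open import Relation.Binary.Definitions using (DecidableEquality)
open import Relation.Binary.PropositionalEquality
open import Relation.Nullary using (¬_; Dec; yes; no; map′; ¬?; _×-dec_; _→-dec_)
open import Relation.Nullary.Decidable using (True; False; toWitness; toWitnessFalse; from-yes)
open import Relation.Unary using (Decidable)

open Equivalence using (to)

_≟ᵖ_ : DecidableEquality Post
S ≟ᵖ S = yes refl
S ≟ᵖ I = no λ ()
S ≟ᵖ D = no λ ()
I ≟ᵖ S = no λ ()
I ≟ᵖ I = yes refl
I ≟ᵖ D = no λ ()
D ≟ᵖ S = no λ ()
D ≟ᵖ I = no λ ()
D ≟ᵖ D = yes refl

_≟ᶜ_ : DecidableEquality Color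
Red  ≟ᶜ Red  = yes refl
Red  ≟ᶜ Blue = no λ ()
Blue ≟ᶜ Red  = no λ ()
Blue ≟ᶜ Blue = yes refl

Pos : Set
Pos = Post × Color

pattern Sʳ = S , Red
pattern Sᵇ = S , Blue
pattern Iʳ = I , Red
pattern Iᵇ = I , Blue
pattern Dʳ = D , Red
pattern Dᵇ = D , Blue

third : Post → Post → Post
third S I = D
third I S = D
third S D = I
third D S = I
third I D = S
third D I = S
third p _ = p

third-unique : ∀ p q x → p ≢ q → x ≢ p → x ≢ q → x ≡ third p q
third-unique S I D _ _ _ = refl
third-unique S D I _ _ _ = refl
third-unique I S D _ _ _ = refl
third-unique I D S _ _ _ = refl
third-unique D S I _ _ _ = refl
third-unique D I S _ _ _ = refl
third-unique S S _ p≢q _ _ = ⊥-elim (p≢q refl)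
third-unique I I _ p≢q _ _ = ⊥-elim (p≢q refl)
third-unique D D _ p≢q _ _ = ⊥-elim (p≢q refl)
third-unique S _ S _ x≢p _ = ⊥-elim (x≢p refl)
third-unique I _ I _ x≢p _ = ⊥-elim (x≢p refl)
third-unique D _ D _ x≢p _ = ⊥-elim (x≢p refl)
third-unique _ S S _ _ x≢q = ⊥-elim (x≢q refl)
third-unique _ I I _ _ x≢q = ⊥-elim (x≢q refl)
third-unique _ D D _ _ x≢q = ⊥-elim (x≢q refl)

record Finite (A : Set) : Set where
  field
    elements : List A
    complete : ∀ x → x ∈ elements

open Finite {{...}}

all? : {A : Set} {{_ : Finite A}} {P : A → Set} → Decidable P → Dec (∀ x → P x)
all? P? = map′ (λ ps x → All.lookup ps (complete x)) (λ f → All.tabulate (λ {x} _ → f x))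
               (All.all? P? elements)

instance
  finitePost : Finite Post
  finitePost = record { elements = S ∷ I ∷ D ∷ [] ; complete = λ
    { S → here refl ; I → there (here refl) ; D → there (there (here refl)) } }

  finiteColor : Finite Color
  finiteColor = record { elements = Red ∷ Blue ∷ [] ; complete = λ
    { Red → here refl ; Blue → there (here refl) } }

  finitePos : Finite Pos
  finitePos = record
    { elements = Sʳ ∷ Sᵇ ∷ Iʳ ∷ Iᵇ ∷ Dʳ ∷ Dᵇ ∷ []
    ; complete = λ
      { Sʳ → here refl
      ; Sᵇ → there (here refl)
      ; Iʳ → there (there (here refl))
      ; Iᵇ → there (there (there (here refl)))
      ; Dʳ → there (there (there (there (here refl))))
      ; Dᵇ → there (there (there (there (there (here refl))))) } }

-- States of n + 1 disks: the largest disk is the last entry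

Tower : (n : ℕ) → Pos → State n
Tower n x = replicate n x

module _ {A : Set} where

  lookup-∷ʳ-inject₁ : ∀ {n} (xs : Vec A n) y i → lookup (xs ∷ʳ y) (inject₁ i) ≡ lookup xs i
  lookup-∷ʳ-inject₁ (x ∷ xs) y Fin.zero    = refl
  lookup-∷ʳ-inject₁ (x ∷ xs) y (Fin.suc i) = lookup-∷ʳ-inject₁ xs y i

  lookup-∷ʳ-fromℕ : ∀ {n} (xs : Vec A n) y → lookup (xs ∷ʳ y) (fromℕ n) ≡ y
  lookup-∷ʳ-fromℕ []       y = refl
  lookup-∷ʳ-fromℕ (x ∷ xs) y = lookup-∷ʳ-fromℕ xs y

  ∷ʳ-update-inject₁ : ∀ {n} (xs : Vec A n) y i z → (xs ∷ʳ y) [ inject₁ i ]≔ z ≡ (xs [ i ]≔ z) ∷ʳ y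
  ∷ʳ-update-inject₁ (x ∷ xs) y Fin.zero    z = refl
  ∷ʳ-update-inject₁ (x ∷ xs) y (Fin.suc i) z = cong (x ∷_) (∷ʳ-update-inject₁ xs y i z)

  ∷ʳ-update-fromℕ : ∀ {n} (xs : Vec A n) y z → (xs ∷ʳ y) [ fromℕ n ]≔ z ≡ xs ∷ʳ z
  ∷ʳ-update-fromℕ []       y z = refl
  ∷ʳ-update-fromℕ (x ∷ xs) y z = cong (x ∷_) (∷ʳ-update-fromℕ xs y z)

  replicate-suc-∷ʳ : ∀ n (x : A) → replicate (suc n) x ≡ replicate n x ∷ʳ x
  replicate-suc-∷ʳ zero    x = refl
  replicate-suc-∷ʳ (suc n) x = cong (x ∷_) (replicate-suc-∷ʳ n x)

  lookup-const⇒replicate : ∀ {n} (xs : Vec A n) x → (∀ i → lookup xs i ≡ x) → xs ≡ replicate n x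
  lookup-const⇒replicate []       x h = refl
  lookup-const⇒replicate (y ∷ xs) x h = cong₂ _∷_ (h Fin.zero) (lookup-const⇒replicate xs x (h ∘ Fin.suc))

inject₁-<-fromℕ : ∀ {n} (i : Fin n) → inject₁ i Fin.< fromℕ n
inject₁-<-fromℕ {n} i rewrite toℕ-inject₁ i | toℕ-fromℕ n = toℕ<n i

fromℕ-≮-inject₁ : ∀ {n} (i : Fin n) → ¬ fromℕ n Fin.< inject₁ i
fromℕ-≮-inject₁ {n} i lt rewrite toℕ-inject₁ i | toℕ-fromℕ n = <⇒≱ (toℕ<n i) (<⇒≤ lt)

inject₁-<-inject₁ : ∀ {n} {i j : Fin n} → i Fin.< j → inject₁ i Fin.< inject₁ j
inject₁-<-inject₁ {i = i} {j} lt rewrite toℕ-inject₁ i | toℕ-inject₁ j = lt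

inject₁-<-inject₁⁻ : ∀ {n} {i j : Fin n} → inject₁ i Fin.< inject₁ j → i Fin.< j
inject₁-<-inject₁⁻ {i = i} {j} lt rewrite toℕ-inject₁ i | toℕ-inject₁ j = lt

-- Invariants of legal play

Fits : PostColoring → Pos → Set
Fits pc (p , c) = ∀ c' → pc p ≡ just c' → c ≡ c'

fits? : ∀ pc → Decidable (Fits pc)
fits? pc (p , c) with pc p
... | nothing = yes λ _ ()
... | just c' = map′ (λ { refl _ refl → refl }) (λ f → f c' refl) (c ≟ᶜ c')

some-fit : ∀ pc p → Σ Color λ c → Fits pc (p , c)
some-fit pc p with pc p
... | nothing = Red , λ _ ()
... | just c  = c , λ { _ refl → refl }

Monochrome : ∀ {n} → State n → Set
Monochrome s = ∀ d e → postOf s d ≡ postOf s e → colorOf s d ≡ colorOf s e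

Respects : ∀ {n} → PostColoring → State n → Set
Respects pc s = ∀ d → Fits pc (lookup s d)

module _ {N} {pc : PostColoring} {s t : State N} (m : Move pc s t) where
  open Move m

  lookup-moved : lookup t disk ≡ (target , flipC (colorOf s disk))
  lookup-moved = trans (cong (λ v → lookup v disk) result) (lookup∘update disk s _)

  lookup-unmoved : ∀ {e} → e ≢ disk → lookup t e ≡ lookup s e
  lookup-unmoved {e} e≢d = trans (cong (λ v → lookup v e) result) (lookup∘update′ e≢d s _)

  moved-vs-unmoved : ∀ {f} → f ≢ disk → postOf t disk ≡ postOf t f → colorOf t disk ≡ colorOf t f
  moved-vs-unmoved {f} f≢d eq = begin
    colorOf t disk           ≡⟨ cong proj₂ lookup-moved ⟩
    flipC (colorOf s disk)   ≡⟨ sym (magnetOK f f-on-target) ⟩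
    colorOf s f              ≡⟨ cong proj₂ (sym (lookup-unmoved f≢d)) ⟩
    colorOf t f              ∎
    where
      open ≡-Reasoning
      f-on-target : postOf s f ≡ target
      f-on-target = trans (cong proj₁ (sym (lookup-unmoved f≢d))) (trans (sym eq) (cong proj₁ lookup-moved))

  move-monochrome : Monochrome s → Monochrome t
  move-monochrome mono e f eq with e Fin.≟ disk | f Fin.≟ disk
  ... | yes refl | yes refl = refl
  ... | yes refl | no f≢d   = moved-vs-unmoved f≢d eq
  ... | no e≢d   | yes refl = sym (moved-vs-unmoved e≢d (sym eq))
  ... | no e≢d   | no f≢d   = begin
    colorOf t e ≡⟨ cong proj₂ (lookup-unmoved e≢d) ⟩
    colorOf s e ≡⟨ mono e f (trans (cong proj₁ (sym (lookup-unmoved e≢d))) (trans eq (cong proj₁ (lookup-unmoved f≢d)))) ⟩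
    colorOf s f ≡⟨ cong proj₂ (sym (lookup-unmoved f≢d)) ⟩
    colorOf t f ∎
    where open ≡-Reasoning

  move-respects : Respects pc s → Respects pc t
  move-respects resp d with d Fin.≟ disk
  ... | yes refl = subst (Fits pc) (sym lookup-moved) postOK
  ... | no d≢e   = subst (Fits pc) (sym (lookup-unmoved d≢e)) (resp d)

reach-monochrome : ∀ {N pc k} {s t : State N} → Reach pc k s t → Monochrome s → Monochrome t
reach-monochrome done       = λ mono → mono
reach-monochrome (step m r) = reach-monochrome r ∘ move-monochrome m

reach-respects : ∀ {N pc k} {s t : State N} → Reach pc k s t → Respects pc s → Respects pc t
reach-respects done       = λ resp → resp
reach-respects (step m r) = reach-respects r ∘ move-respects m

_▷_ : ∀ {N pc k} {s t u : State N} → Reach pc k s t → Move pc t u → Reach pc (suc k) s u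
done     ▷ m = step m done
step m' r ▷ m = step m' (r ▷ m)

_++ᴿ_ : ∀ {N pc k l} {s t u : State N} → Reach pc k s t → Reach pc l t u → Reach pc (k + l) s u
done     ++ᴿ r' = r'
step m r ++ᴿ r' = step m (r ++ᴿ r')

move-cong : ∀ {N pc pc'} {s t : State N} → pc ≗ pc' → Move pc s t → Move pc' s t
move-cong pc≗pc' m = record
  { disk = disk ; target = target ; different = different ; isTop = isTop ; sizeOK = sizeOK
  ; magnetOK = magnetOK ; postOK = λ c eq → postOK c (trans (pc≗pc' target) eq) ; result = result }
  where open Move m

reach-cong : ∀ {N pc pc' k} {s t : State N} → pc ≗ pc' → Reach pc k s t → Reach pc' k s t
reach-cong pc≗pc' done       = done
reach-cong pc≗pc' (step m r) = step (move-cong pc≗pc' m) (reach-cong pc≗pc' r)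

tower-monochrome : ∀ n x → Monochrome (Tower n x)
tower-monochrome n x d e _ rewrite lookup-replicate d x | lookup-replicate e x = refl

tower-respects : ∀ {pc} n x → Fits pc x → Respects pc (Tower n x)
tower-respects n x fit d rewrite lookup-replicate d x = fit

one-post⇒tower : ∀ {n pc} (xs : State n) r → (∀ i → postOf xs i ≡ r) → Monochrome xs → Respects pc xs
               → Σ Color λ c → Fits pc (r , c) × xs ≡ Tower n (r , c)
one-post⇒tower {pc = pc} [] r _ _ _ = proj₁ (some-fit pc r) , proj₂ (some-fit pc r) , refl
one-post⇒tower {pc = pc} xs@(_ ∷ _) r on-r mono resp =
  colorOf xs Fin.zero , subst (λ p → Fits pc (p , colorOf xs Fin.zero)) (on-r Fin.zero) (resp Fin.zero) ,
  lookup-const⇒replicate xs _ λ i → cong₂ _,_ (on-r i) (mono i Fin.zero (trans (on-r i) (sym (on-r Fin.zero))))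

-- Once the largest disk shows colour c on post p, the smaller disks
-- see p as a post pre-coloured c.
above : PostColoring → Pos → PostColoring
above pc (p , c) q with q ≟ᵖ p
... | yes _ = just c
... | no _  = pc q

above-here : ∀ pc p c → above pc (p , c) p ≡ just c
above-here pc p c with p ≟ᵖ p
... | yes _  = refl
... | no p≢p = ⊥-elim (p≢p refl)

fits-above : ∀ {pc p c q c'} → Fits pc (q , c') → (q ≡ p → c' ≡ c) → Fits (above pc (p , c)) (q , c')
fits-above {pc} {p} {c} {q} fit on-p c'' eq with q ≟ᵖ p
... | yes q≡p = trans (on-p q≡p) (just-injective eq)
... | no _    = fit c'' eq

fits-above-here : ∀ {pc p c c'} → Fits (above pc (p , c)) (p , c') → c' ≡ c
fits-above-here {pc} {p} {c} fit = fit c (above-here pc p c)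

fits-above⁻ : ∀ {pc p c y} → Fits pc (p , c) → Fits (above pc (p , c)) y → Fits pc y
fits-above⁻ {pc} {p} {c} {q , c'} fit-x fit-y c'' eq with q ≟ᵖ p
... | yes refl = trans (fit-y c refl) (fit-x c'' eq)
... | no _     = fit-y c'' eq

module _ {n : ℕ} (xs : State n) (x : Pos) where
  private
    s : State (suc n)
    s = xs ∷ʳ x

  post-inject₁ : ∀ i → postOf s (inject₁ i) ≡ postOf xs i
  post-inject₁ i = cong proj₁ (lookup-∷ʳ-inject₁ xs x i)

  color-inject₁ : ∀ i → colorOf s (inject₁ i) ≡ colorOf xs i
  color-inject₁ i = cong proj₂ (lookup-∷ʳ-inject₁ xs x i)

  post-fromℕ : postOf s (fromℕ n) ≡ proj₁ x
  post-fromℕ = cong proj₁ (lookup-∷ʳ-fromℕ xs x)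

  color-fromℕ : colorOf s (fromℕ n) ≡ proj₂ x
  color-fromℕ = cong proj₂ (lookup-∷ʳ-fromℕ xs x)

data MoveView {n : ℕ} (pc : PostColoring) (xs : State n) : Pos → State (suc n) → Set where
  small : ∀ {x ys} → Move (above pc x) xs ys → MoveView pc xs x (ys ∷ʳ x)
  large : ∀ {p c} q → q ≢ p → (∀ i → postOf xs i ≢ p) → (∀ i → postOf xs i ≢ q) → Fits pc (q , flipC c)
        → MoveView pc xs (p , c) (xs ∷ʳ (q , flipC c))

moveView : ∀ {n pc} {xs : State n} {x t} → Move pc (xs ∷ʳ x) t → MoveView pc xs x t
moveView {n} {pc} {xs} {x} {t} record
  { disk = d ; target = q ; different = q≢d ; isTop = d-top ; sizeOK = d<q ; magnetOK = q-color
  ; postOK = fit ; result = t≡ } with view d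
... | ‵fromℕ = subst (MoveView pc xs x) (sym t≡′) (large q
  (λ eq → q≢d (trans eq (sym (post-fromℕ xs x))))
  (λ i eq → d-top (inject₁ i) (inject₁-<-fromℕ i) (trans (post-inject₁ xs x i) (trans eq (sym (post-fromℕ xs x)))))
  (λ i eq → fromℕ-≮-inject₁ i (d<q (inject₁ i) (trans (post-inject₁ xs x i) eq)))
  (subst (λ c → Fits pc (q , flipC c)) (color-fromℕ xs x) fit))
  where
    t≡′ : t ≡ xs ∷ʳ (q , flipC (proj₂ x))
    t≡′ = trans t≡ (trans (cong (λ c → (xs ∷ʳ x) [ fromℕ n ]≔ (q , flipC c)) (color-fromℕ xs x))
                          (∷ʳ-update-fromℕ xs x _))
... | ‵inject₁ i = subst (MoveView pc xs x) (sym t≡′) (small (record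
  { disk = i ; target = q
  ; different = λ eq → q≢d (trans eq (sym (post-inject₁ xs x i)))
  ; isTop = λ e e<i eq → d-top (inject₁ e) (inject₁-<-inject₁ e<i)
                           (trans (post-inject₁ xs x e) (trans eq (sym (post-inject₁ xs x i))))
  ; sizeOK = λ e eq → inject₁-<-inject₁⁻ (d<q (inject₁ e) (trans (post-inject₁ xs x e) eq))
  ; magnetOK = λ e eq → trans (sym (color-inject₁ xs x e))
                          (trans (q-color (inject₁ e) (trans (post-inject₁ xs x e) eq)) (cong flipC (color-inject₁ xs x i)))
  ; postOK = fits-above (subst (λ c → Fits pc (q , flipC c)) (color-inject₁ xs x i) fit) lands-on-largest
  ; result = refl }))
  where
    t≡′ : t ≡ (xs [ i ]≔ (q , flipC (colorOf xs i))) ∷ʳ x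
    t≡′ = trans t≡ (trans (cong (λ c → (xs ∷ʳ x) [ inject₁ i ]≔ (q , flipC c)) (color-inject₁ xs x i))
                          (∷ʳ-update-inject₁ xs x i _))
    lands-on-largest : q ≡ proj₁ x → flipC (colorOf xs i) ≡ proj₂ x
    lands-on-largest q≡p = trans (cong flipC (sym (color-inject₁ xs x i)))
      (trans (sym (q-color (fromℕ n) (trans (post-fromℕ xs x) (sym q≡p)))) (color-fromℕ xs x))

module _ {n : ℕ} {pc : PostColoring} {x : Pos} (fit-x : Fits pc x) where

  lift-move : ∀ {xs ys : State n} → Move (above pc x) xs ys → Move pc (xs ∷ʳ x) (ys ∷ʳ x)
  lift-move {xs} {ys} m = record
    { disk = inject₁ disk ; target = target
    ; different = λ eq → different (trans eq (post-inject₁ xs x disk))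
    ; isTop = d-top
    ; sizeOK = d<
    ; magnetOK = d-color
    ; postOK = subst (λ c → Fits pc (target , flipC c)) (sym (color-inject₁ xs x disk)) (fits-above⁻ {pc} {proj₁ x} {proj₂ x} fit-x postOK)
    ; result = begin
        ys ∷ʳ x                                                      ≡⟨ cong (_∷ʳ x) result ⟩
        (xs [ disk ]≔ (target , flipC (colorOf xs disk))) ∷ʳ x       ≡⟨ sym (∷ʳ-update-inject₁ xs x disk _) ⟩
        s [ inject₁ disk ]≔ (target , flipC (colorOf xs disk))       ≡⟨ cong (λ c → s [ inject₁ disk ]≔ (target , flipC c))
                                                                              (sym (color-inject₁ xs x disk)) ⟩
        s [ inject₁ disk ]≔ (target , flipC (colorOf s (inject₁ disk))) ∎ }
    where
      open Move m
      open ≡-Reasoning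
      s : State (suc n)
      s = xs ∷ʳ x
      d-top : ∀ e → e Fin.< inject₁ disk → postOf s e ≢ postOf s (inject₁ disk)
      d-top e lt with view e
      ... | ‵fromℕ     = ⊥-elim (fromℕ-≮-inject₁ disk lt)
      ... | ‵inject₁ j = λ eq → isTop j (inject₁-<-inject₁⁻ lt)
                                  (trans (sym (post-inject₁ xs x j)) (trans eq (post-inject₁ xs x disk)))
      d< : ∀ e → postOf s e ≡ target → inject₁ disk Fin.< e
      d< e eq with view e
      ... | ‵fromℕ     = inject₁-<-fromℕ disk
      ... | ‵inject₁ j = inject₁-<-inject₁ (sizeOK j (trans (sym (post-inject₁ xs x j)) eq))
      d-color : ∀ e → postOf s e ≡ target → colorOf s e ≡ flipC (colorOf s (inject₁ disk))
      d-color e eq with view e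
      ... | ‵fromℕ     = trans (color-fromℕ xs x)
        (sym (trans (cong flipC (color-inject₁ xs x disk))
               (fits-above-here {pc} {proj₁ x} {proj₂ x} (subst (λ q → Fits (above pc x) (q , _)) (trans (sym eq) (post-fromℕ xs x)) postOK))))
      ... | ‵inject₁ j = trans (color-inject₁ xs x j)
        (trans (magnetOK j (trans (sym (post-inject₁ xs x j)) eq)) (cong flipC (sym (color-inject₁ xs x disk))))

  lift-reach : ∀ {k} {xs ys : State n} → Reach (above pc x) k xs ys → Reach pc k (xs ∷ʳ x) (ys ∷ʳ x)
  lift-reach done       = done
  lift-reach (step m r) = step (lift-move m) (lift-reach r)

large-move : ∀ {n pc p c} {xs : State n} q → q ≢ p → (∀ i → postOf xs i ≢ p) → (∀ i → postOf xs i ≢ q)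
           → Fits pc (q , flipC c) → Move pc (xs ∷ʳ (p , c)) (xs ∷ʳ (q , flipC c))
large-move {n} {pc} {p} {c} {xs} q q≢p off-p off-q fit = record
  { disk = fromℕ n ; target = q
  ; different = λ eq → q≢p (trans eq (post-fromℕ xs (p , c)))
  ; isTop = top
  ; sizeOK = λ e eq → ⊥-elim (q-empty e eq)
  ; magnetOK = λ e eq → ⊥-elim (q-empty e eq)
  ; postOK = subst (λ c′ → Fits pc (q , flipC c′)) (sym (color-fromℕ xs (p , c))) fit
  ; result = sym (trans (cong (λ c′ → s [ fromℕ n ]≔ (q , flipC c′)) (color-fromℕ xs (p , c)))
                        (∷ʳ-update-fromℕ xs (p , c) _)) }
  where
    s : State (suc n)
    s = xs ∷ʳ (p , c)
    top : ∀ e → e Fin.< fromℕ n → postOf s e ≢ postOf s (fromℕ n)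
    top e lt with view e
    ... | ‵fromℕ     = ⊥-elim (<-irrefl refl lt)
    ... | ‵inject₁ j = λ eq → off-p j (trans (sym (post-inject₁ xs (p , c) j)) (trans eq (post-fromℕ xs (p , c))))
    q-empty : ∀ e → postOf s e ≢ q
    q-empty e eq with view e
    ... | ‵fromℕ     = q≢p (trans (sym eq) (post-fromℕ xs (p , c)))
    ... | ‵inject₁ j = off-q j (trans (sym (post-inject₁ xs (p , c) j)) eq)

-- Linear forms in the basis sequences

-- A = S1000, P = S727 and R = S909; Q and T are two auxiliary distances
-- that close the recurrence.
record Basis : Set where
  constructor basis⟨_,_,_,_,_⟩
  field
    bA bP bQ bR bT : ℕ

nextBasis : Basis → Basis
nextBasis basis⟨ A , P , Q , R , T ⟩ =
  basis⟨ 3 * A + 1 , Q + R + 1 , 2 * A + 2 * R + 2 , 2 * A + P + 1 , 4 * A + Q + R + 3 ⟩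

basis : ℕ → Basis
basis zero    = basis⟨ 0 , 0 , 0 , 0 , 0 ⟩
basis (suc n) = nextBasis (basis n)

record Form : Set where
  constructor fm
  field
    a p q r t c : ℕ

eval : Form → Basis → ℕ
eval (fm a p q r t c) basis⟨ A , P , Q , R , T ⟩ = a * A + p * P + q * Q + r * R + t * T + c

infixl 6 _⊕_
infixl 7 _·_

_⊕_ : Form → Form → Form
fm a p q r t c ⊕ fm a′ p′ q′ r′ t′ c′ = fm (a + a′) (p + p′) (q + q′) (r + r′) (t + t′) (c + c′)

_·_ : ℕ → Form → Form
k · fm a p q r t c = fm (k * a) (k * p) (k * q) (k * r) (k * t) (k * c)

𝐀 𝐏 𝐐 𝐑 𝐓 : Form
𝐀 = fm 1 0 0 0 0 0
𝐏 = fm 0 1 0 0 0 0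
𝐐 = fm 0 0 1 0 0 0
𝐑 = fm 0 0 0 1 0 0
𝐓 = fm 0 0 0 0 1 0

#_ : ℕ → Form
# c = fm 0 0 0 0 0 c

-- The transpose of nextBasis: eval f (nextBasis β) ≡ eval (pull f) β.
pull : Form → Form
pull (fm a p q r t c) =
  fm (3 * a + 2 * q + 2 * r + 4 * t) r (p + t) (p + 2 * q + t) 0 (a + p + 2 * q + r + 3 * t + c)

eval-pull : ∀ f β → eval f (nextBasis β) ≡ eval (pull f) β
eval-pull (fm a p q r t c) basis⟨ A , P , Q , R , T ⟩ = lemma a p q r t c A P Q R T
  where
    lemma : ∀ a p q r t c A P Q R T →
      a * (3 * A + 1) + p * (Q + R + 1) + q * (2 * A + 2 * R + 2) + r * (2 * A + P + 1)
        + t * (4 * A + Q + R + 3) + c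
      ≡ (3 * a + 2 * q + 2 * r + 4 * t) * A + r * P + (p + t) * Q + (p + 2 * q + t) * R + 0 * T
        + (a + p + 2 * q + r + 3 * t + c)
    lemma = solve-∀

eval-⊕ : ∀ f g β → eval (f ⊕ g) β ≡ eval f β + eval g β
eval-⊕ (fm a p q r t c) (fm a′ p′ q′ r′ t′ c′) basis⟨ A , P , Q , R , T ⟩ =
  lemma a p q r t c a′ p′ q′ r′ t′ c′ A P Q R T
  where
    lemma : ∀ a p q r t c a′ p′ q′ r′ t′ c′ A P Q R T →
      (a + a′) * A + (p + p′) * P + (q + q′) * Q + (r + r′) * R + (t + t′) * T + (c + c′)
      ≡ (a * A + p * P + q * Q + r * R + t * T + c) + (a′ * A + p′ * P + q′ * Q + r′ * R + t′ * T + c′)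
    lemma = solve-∀

_≤ᶠ_ : Form → Form → Bool
fm a p q r t c ≤ᶠ fm a′ p′ q′ r′ t′ c′ =
  (a ≤ᵇ a′) ∧ (p ≤ᵇ p′) ∧ (q ≤ᵇ q′) ∧ (r ≤ᵇ r′) ∧ (t ≤ᵇ t′) ∧ (c ≤ᵇ c′)

≤ᶠ-sound : ∀ f g β → T (f ≤ᶠ g) → eval f β ≤ eval g β
≤ᶠ-sound (fm a p q r t c) (fm a′ p′ q′ r′ t′ c′) basis⟨ A , P , Q , R , T ⟩ le
  with to T-∧ le
... | a≤ , le₁ with to T-∧ le₁
... | p≤ , le₂ with to T-∧ le₂
... | q≤ , le₃ with to T-∧ le₃
... | r≤ , le₄ with to T-∧ le₄
... | t≤ , c≤ =
  +-mono-≤ (+-mono-≤ (+-mono-≤ (+-mono-≤ (+-mono-≤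
    (*-monoˡ-≤ A (≤ᵇ⇒≤ a a′ a≤)) (*-monoˡ-≤ P (≤ᵇ⇒≤ p p′ p≤))) (*-monoˡ-≤ Q (≤ᵇ⇒≤ q q′ q≤)))
    (*-monoˡ-≤ R (≤ᵇ⇒≤ r r′ r≤))) (*-monoˡ-≤ T (≤ᵇ⇒≤ t t′ t≤))) (≤ᵇ⇒≤ c c′ c≤)

basics : List (Form × Form)
basics = (𝐏 , 𝐑) ∷ (𝐑 , 𝐐) ∷ (𝐐 , 𝐏 ⊕ 𝐑) ∷ (𝐐 , 𝐑 ⊕ 𝐓) ∷ (𝐐 ⊕ 𝐑 , 2 · 𝐀 ⊕ 𝐏) ∷ (𝐏 , 2 · 𝐀) ∷ []

Holds : Basis → Form × Form → Set
Holds β (lo , hi) = eval lo β ≤ eval hi β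

-- f ≤ g follows coefficientwise after adding up to d of the basic
-- inequalities lo ≤ hi (as f + hi ≤ g + lo).
entails : ℕ → Form → Form → Bool
entails zero    f g = f ≤ᶠ g
entails (suc d) f g = f ≤ᶠ g ∨ any (uncurry λ lo hi → entails d (f ⊕ hi) (g ⊕ lo)) basics

entails-sound : ∀ {β} → All (Holds β) basics → ∀ d f g → T (entails d f g) → eval f β ≤ eval g β
entails-sound {β} _ zero f g ok = ≤ᶠ-sound f g β ok
entails-sound {β} hyp (suc d) f g ok with to T-∨ ok
... | inj₁ direct = ≤ᶠ-sound f g β direct
... | inj₂ some   = All.lookupWith (λ {lh} → via-basic {lh}) hyp (any⁻ _ basics some)
  where
    via-basic : ∀ {lh} → Holds β lh → T (entails d (f ⊕ proj₂ lh) (g ⊕ proj₁ lh))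
              → eval f β ≤ eval g β
    via-basic {lo , hi} lo≤hi ok′ = +-cancelʳ-≤ (eval hi β) (eval f β) (eval g β) (begin
      eval f β + eval hi β  ≡⟨ sym (eval-⊕ f hi β) ⟩
      eval (f ⊕ hi) β       ≤⟨ entails-sound hyp d (f ⊕ hi) (g ⊕ lo) ok′ ⟩
      eval (g ⊕ lo) β       ≡⟨ eval-⊕ g lo β ⟩
      eval g β + eval lo β  ≤⟨ +-monoʳ-≤ (eval g β) lo≤hi ⟩
      eval g β + eval hi β  ∎)
      where open ≤-Reasoning

infix 4 _≼_
record _≼_ (f g : Form) : Set where
  constructor certified
  field
    certificate : T (entails 2 f g)

basics-pull : All (uncurry λ lo hi → pull lo ≼ pull hi) basics
basics-pull = _ ∷ _ ∷ _ ∷ _ ∷ _ ∷ _ ∷ []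

basics-hold : ∀ n → All (Holds (basis n)) basics
basics-hold zero    = z≤n ∷ z≤n ∷ z≤n ∷ z≤n ∷ z≤n ∷ z≤n ∷ []
basics-hold (suc n) = All.map (λ {(lo , hi)} ok →
    subst₂ _≤_ (sym (eval-pull lo (basis n))) (sym (eval-pull hi (basis n)))
           (entails-sound (basics-hold n) 2 (pull lo) (pull hi) (_≼_.certificate ok)))
  basics-pull

≼-sound : ∀ {f g} → f ≼ g → ∀ n → eval f (basis n) ≤ eval g (basis n)
≼-sound {f} {g} (certified ok) n = entails-sound (basics-hold n) 2 f g ok

precolored : Color → Color → Color → PostColoring
precolored cS cI cD S = just cS
precolored cS cI cD I = just cI
precolored cS cI cD D = just cD

-- The colourings met by towers of smaller disks when the game starts in
-- RBN or NRB: placing the largest disk on a neutral post pre-colours it.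
data Scheme : Set where
  RBN NRB RBB RBR RRB BRB : Scheme

⟦_⟧ : Scheme → PostColoring
⟦ RBN ⟧ = colRBN
⟦ NRB ⟧ = colNRB
⟦ RBB ⟧ = precolored Red Blue Blue
⟦ RBR ⟧ = precolored Red Blue Red
⟦ RRB ⟧ = precolored Red Red Blue
⟦ BRB ⟧ = precolored Blue Red Blue

-- Only meaningful when x fits ⟦ κ ⟧ (see ▸-agrees).
infixl 5 _▸_
_▸_ : Scheme → Pos → Scheme
RBN ▸ Dʳ = RBR
RBN ▸ Dᵇ = RBB
NRB ▸ Sʳ = RRB
NRB ▸ Sᵇ = BRB
κ   ▸ _  = κ

instance
  finiteScheme : Finite Scheme
  finiteScheme = record
    { elements = RBN ∷ NRB ∷ RBB ∷ RBR ∷ RRB ∷ BRB ∷ []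
    ; complete = λ
      { RBN → here refl
      ; NRB → there (here refl)
      ; RBB → there (there (here refl))
      ; RBR → there (there (there (here refl)))
      ; RRB → there (there (there (there (here refl))))
      ; BRB → there (there (there (there (there (here refl))))) } }

-- Evaluated at basis n, cost κ a b is the least number of moves taking a
-- tower of n disks from a to b under ⟦ κ ⟧.
cost : Scheme → Pos → Pos → Form
cost RBN Sʳ Iᵇ = 𝐏
cost RBN Sʳ Dʳ = 𝐐
cost RBN Sʳ Dᵇ = 𝐑
cost RBN Iᵇ Sʳ = 𝐏
cost RBN Iᵇ Dʳ = 𝐑
cost RBN Iᵇ Dᵇ = 𝐐
cost RBN Dʳ Sʳ = 𝐐
cost RBN Dʳ Iᵇ = 𝐑
cost RBN Dʳ Dᵇ = 𝐓
cost RBN Dᵇ Sʳ = 𝐑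
cost RBN Dᵇ Iᵇ = 𝐐
cost RBN Dᵇ Dʳ = 𝐓
cost NRB Sʳ Sᵇ = 𝐓
cost NRB Sʳ Iʳ = 𝐐
cost NRB Sʳ Dᵇ = 𝐑
cost NRB Sᵇ Sʳ = 𝐓
cost NRB Sᵇ Iʳ = 𝐑
cost NRB Sᵇ Dᵇ = 𝐐
cost NRB Iʳ Sʳ = 𝐐
cost NRB Iʳ Sᵇ = 𝐑
cost NRB Iʳ Dᵇ = 𝐏
cost NRB Dᵇ Sʳ = 𝐑
cost NRB Dᵇ Sᵇ = 𝐐
cost NRB Dᵇ Iʳ = 𝐏
cost RBB Sʳ Iᵇ = 𝐀
cost RBB Sʳ Dᵇ = 𝐀
cost RBB Iᵇ Sʳ = 𝐀
cost RBB Iᵇ Dᵇ = 2 · 𝐀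
cost RBB Dᵇ Sʳ = 𝐀
cost RBB Dᵇ Iᵇ = 2 · 𝐀
cost RBR Sʳ Iᵇ = 𝐀
cost RBR Sʳ Dʳ = 2 · 𝐀
cost RBR Iᵇ Sʳ = 𝐀
cost RBR Iᵇ Dʳ = 𝐀
cost RBR Dʳ Sʳ = 2 · 𝐀
cost RBR Dʳ Iᵇ = 𝐀
cost RRB Sʳ Iʳ = 2 · 𝐀
cost RRB Sʳ Dᵇ = 𝐀
cost RRB Iʳ Sʳ = 2 · 𝐀
cost RRB Iʳ Dᵇ = 𝐀
cost RRB Dᵇ Sʳ = 𝐀
cost RRB Dᵇ Iʳ = 𝐀
cost BRB Sᵇ Iʳ = 𝐀
cost BRB Sᵇ Dᵇ = 2 · 𝐀
cost BRB Iʳ Sᵇ = 𝐀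
cost BRB Iʳ Dᵇ = 𝐀
cost BRB Dᵇ Sᵇ = 2 · 𝐀
cost BRB Dᵇ Iʳ = 𝐀
cost _ _ _ = # 0

-- Evaluated at basis n, potential κ b x y bounds from below the number of
-- moves needed to bring n + 1 disks, the largest at x and the others
-- stacked at y, into a tower at b.
potential : Scheme → Pos → Pos → Pos → Form
potential RBN Sʳ Sʳ Iᵇ = 𝐏
potential RBN Sʳ Sʳ Dʳ = 𝐐
potential RBN Sʳ Sʳ Dᵇ = 𝐑
potential RBN Sʳ Iᵇ Dʳ = 𝐐 ⊕ # 1
potential RBN Sʳ Iᵇ Dᵇ = 𝐑 ⊕ # 1
potential RBN Sʳ Dᵇ Iᵇ = 𝐏 ⊕ # 1
potential RBN Sʳ Dᵇ Dᵇ = 2 · 𝐀 ⊕ 𝐏 ⊕ # 1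
potential RBN Sʳ Iᵇ Sʳ = 2 · 𝐑 ⊕ # 1
potential RBN Sʳ Iᵇ Iᵇ = 𝐐 ⊕ 𝐑 ⊕ # 1
potential RBN Sʳ Dʳ Sʳ = 2 · 𝐑 ⊕ # 2
potential RBN Sʳ Dʳ Iᵇ = 𝐀 ⊕ 2 · 𝐑 ⊕ # 2
potential RBN Sʳ Dʳ Dʳ = 2 · 𝐀 ⊕ 2 · 𝐑 ⊕ # 2
potential RBN Sʳ Dᵇ Sʳ = 𝐀 ⊕ 𝐏 ⊕ # 1
potential RBN Iᵇ Iᵇ Sʳ = 𝐏
potential RBN Iᵇ Iᵇ Dʳ = 𝐑
potential RBN Iᵇ Iᵇ Dᵇ = 𝐐
potential RBN Iᵇ Dʳ Sʳ = 𝐏 ⊕ # 1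
potential RBN Iᵇ Dʳ Iᵇ = 𝐀 ⊕ 𝐏 ⊕ # 1
potential RBN Iᵇ Dʳ Dʳ = 2 · 𝐀 ⊕ 𝐏 ⊕ # 1
potential RBN Iᵇ Sʳ Dʳ = 𝐑 ⊕ # 1
potential RBN Iᵇ Sʳ Dᵇ = 𝐐 ⊕ # 1
potential RBN Iᵇ Sʳ Sʳ = 𝐐 ⊕ 𝐑 ⊕ # 1
potential RBN Iᵇ Sʳ Iᵇ = 2 · 𝐑 ⊕ # 1
potential RBN Iᵇ Dᵇ Iᵇ = 2 · 𝐑 ⊕ # 2
potential RBN Iᵇ Dᵇ Dᵇ = 2 · 𝐀 ⊕ 2 · 𝐑 ⊕ # 2
potential RBN Iᵇ Dᵇ Sʳ = 𝐀 ⊕ 2 · 𝐑 ⊕ # 2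
potential RBN Dʳ Dʳ Sʳ = 2 · 𝐀
potential RBN Dʳ Dʳ Iᵇ = 𝐀
potential RBN Dʳ Iᵇ Sʳ = 2 · 𝐀 ⊕ # 1
potential RBN Dʳ Iᵇ Iᵇ = 2 · 𝐀 ⊕ 𝐏 ⊕ # 1
potential RBN Dʳ Iᵇ Dʳ = 2 · 𝐀 ⊕ 𝐐 ⊕ # 1
potential RBN Dʳ Iᵇ Dᵇ = 2 · 𝐀 ⊕ 𝐑 ⊕ # 1
potential RBN Dʳ Sʳ Dʳ = 2 · 𝐀 ⊕ 𝐐 ⊕ # 2
potential RBN Dʳ Sʳ Dᵇ = 2 · 𝐀 ⊕ 𝐑 ⊕ # 2
potential RBN Dʳ Sʳ Sʳ = 2 · 𝐀 ⊕ 2 · 𝐑 ⊕ # 2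
potential RBN Dʳ Sʳ Iᵇ = 2 · 𝐀 ⊕ 𝐐 ⊕ 𝐑 ⊕ # 2
potential RBN Dʳ Dᵇ Iᵇ = 2 · 𝐀 ⊕ 𝐐 ⊕ 𝐑 ⊕ # 3
potential RBN Dʳ Dᵇ Dᵇ = 4 · 𝐀 ⊕ 𝐐 ⊕ 𝐑 ⊕ # 3
potential RBN Dʳ Dᵇ Sʳ = 3 · 𝐀 ⊕ 𝐐 ⊕ 𝐑 ⊕ # 3
potential RBN Dᵇ Dᵇ Sʳ = 𝐀
potential RBN Dᵇ Dᵇ Iᵇ = 2 · 𝐀
potential RBN Dᵇ Sʳ Iᵇ = 2 · 𝐀 ⊕ # 1
potential RBN Dᵇ Sʳ Dʳ = 2 · 𝐀 ⊕ 𝐑 ⊕ # 1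
potential RBN Dᵇ Sʳ Dᵇ = 2 · 𝐀 ⊕ 𝐐 ⊕ # 1
potential RBN Dᵇ Iᵇ Dʳ = 2 · 𝐀 ⊕ 𝐑 ⊕ # 2
potential RBN Dᵇ Iᵇ Dᵇ = 2 · 𝐀 ⊕ 𝐐 ⊕ # 2
potential RBN Dᵇ Sʳ Sʳ = 2 · 𝐀 ⊕ 𝐏 ⊕ # 1
potential RBN Dᵇ Iᵇ Sʳ = 2 · 𝐀 ⊕ 𝐐 ⊕ 𝐑 ⊕ # 2
potential RBN Dᵇ Iᵇ Iᵇ = 2 · 𝐀 ⊕ 2 · 𝐑 ⊕ # 2
potential RBN Dᵇ Dʳ Sʳ = 2 · 𝐀 ⊕ 𝐐 ⊕ 𝐑 ⊕ # 3
potential RBN Dᵇ Dʳ Iᵇ = 3 · 𝐀 ⊕ 𝐐 ⊕ 𝐑 ⊕ # 3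
potential RBN Dᵇ Dʳ Dʳ = 4 · 𝐀 ⊕ 𝐐 ⊕ 𝐑 ⊕ # 3
potential NRB Sʳ Sʳ Iʳ = 2 · 𝐀
potential NRB Sʳ Sʳ Dᵇ = 𝐀
potential NRB Sʳ Dᵇ Iʳ = 2 · 𝐀 ⊕ # 1
potential NRB Sʳ Dᵇ Dᵇ = 2 · 𝐀 ⊕ 𝐏 ⊕ # 1
potential NRB Sʳ Dᵇ Sʳ = 2 · 𝐀 ⊕ 𝐐 ⊕ # 1
potential NRB Sʳ Dᵇ Sᵇ = 2 · 𝐀 ⊕ 𝐑 ⊕ # 1
potential NRB Sʳ Iʳ Sʳ = 2 · 𝐀 ⊕ 𝐐 ⊕ # 2
potential NRB Sʳ Iʳ Sᵇ = 2 · 𝐀 ⊕ 𝐑 ⊕ # 2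
potential NRB Sʳ Iʳ Iʳ = 2 · 𝐀 ⊕ 2 · 𝐑 ⊕ # 2
potential NRB Sʳ Iʳ Dᵇ = 2 · 𝐀 ⊕ 𝐐 ⊕ 𝐑 ⊕ # 2
potential NRB Sʳ Sᵇ Dᵇ = 2 · 𝐀 ⊕ 𝐐 ⊕ 𝐑 ⊕ # 3
potential NRB Sʳ Sᵇ Sᵇ = 4 · 𝐀 ⊕ 𝐐 ⊕ 𝐑 ⊕ # 3
potential NRB Sʳ Sᵇ Iʳ = 3 · 𝐀 ⊕ 𝐐 ⊕ 𝐑 ⊕ # 3
potential NRB Sᵇ Sᵇ Iʳ = 𝐀
potential NRB Sᵇ Sᵇ Dᵇ = 2 · 𝐀
potential NRB Sᵇ Iʳ Dᵇ = 2 · 𝐀 ⊕ # 1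
potential NRB Sᵇ Iʳ Sʳ = 2 · 𝐀 ⊕ 𝐑 ⊕ # 1
potential NRB Sᵇ Iʳ Sᵇ = 2 · 𝐀 ⊕ 𝐐 ⊕ # 1
potential NRB Sᵇ Iʳ Iʳ = 2 · 𝐀 ⊕ 𝐏 ⊕ # 1
potential NRB Sᵇ Dᵇ Sʳ = 2 · 𝐀 ⊕ 𝐑 ⊕ # 2
potential NRB Sᵇ Dᵇ Sᵇ = 2 · 𝐀 ⊕ 𝐐 ⊕ # 2
potential NRB Sᵇ Dᵇ Iʳ = 2 · 𝐀 ⊕ 𝐐 ⊕ 𝐑 ⊕ # 2
potential NRB Sᵇ Dᵇ Dᵇ = 2 · 𝐀 ⊕ 2 · 𝐑 ⊕ # 2
potential NRB Sᵇ Sʳ Iʳ = 2 · 𝐀 ⊕ 𝐐 ⊕ 𝐑 ⊕ # 3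
potential NRB Sᵇ Sʳ Dᵇ = 3 · 𝐀 ⊕ 𝐐 ⊕ 𝐑 ⊕ # 3
potential NRB Sᵇ Sʳ Sʳ = 4 · 𝐀 ⊕ 𝐐 ⊕ 𝐑 ⊕ # 3
potential NRB Iʳ Iʳ Sʳ = 𝐐
potential NRB Iʳ Iʳ Sᵇ = 𝐑
potential NRB Iʳ Iʳ Dᵇ = 𝐏
potential NRB Iʳ Dᵇ Sʳ = 𝐐 ⊕ # 1
potential NRB Iʳ Dᵇ Sᵇ = 𝐑 ⊕ # 1
potential NRB Iʳ Dᵇ Iʳ = 2 · 𝐑 ⊕ # 1
potential NRB Iʳ Dᵇ Dᵇ = 𝐐 ⊕ 𝐑 ⊕ # 1
potential NRB Iʳ Sʳ Iʳ = 2 · 𝐑 ⊕ # 2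
potential NRB Iʳ Sʳ Dᵇ = 𝐀 ⊕ 2 · 𝐑 ⊕ # 2
potential NRB Iʳ Sᵇ Dᵇ = 𝐏 ⊕ # 1
potential NRB Iʳ Sʳ Sʳ = 2 · 𝐀 ⊕ 2 · 𝐑 ⊕ # 2
potential NRB Iʳ Sᵇ Sᵇ = 2 · 𝐀 ⊕ 𝐏 ⊕ # 1
potential NRB Iʳ Sᵇ Iʳ = 𝐀 ⊕ 𝐏 ⊕ # 1
potential NRB Dᵇ Dᵇ Sʳ = 𝐑
potential NRB Dᵇ Dᵇ Sᵇ = 𝐐
potential NRB Dᵇ Dᵇ Iʳ = 𝐏
potential NRB Dᵇ Sʳ Iʳ = 𝐏 ⊕ # 1
potential NRB Dᵇ Sʳ Dᵇ = 𝐀 ⊕ 𝐏 ⊕ # 1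
potential NRB Dᵇ Iʳ Sʳ = 𝐑 ⊕ # 1
potential NRB Dᵇ Iʳ Sᵇ = 𝐐 ⊕ # 1
potential NRB Dᵇ Iʳ Iʳ = 𝐐 ⊕ 𝐑 ⊕ # 1
potential NRB Dᵇ Iʳ Dᵇ = 2 · 𝐑 ⊕ # 1
potential NRB Dᵇ Sʳ Sʳ = 2 · 𝐀 ⊕ 𝐏 ⊕ # 1
potential NRB Dᵇ Sᵇ Dᵇ = 2 · 𝐑 ⊕ # 2
potential NRB Dᵇ Sᵇ Sᵇ = 2 · 𝐀 ⊕ 2 · 𝐑 ⊕ # 2
potential NRB Dᵇ Sᵇ Iʳ = 𝐀 ⊕ 2 · 𝐑 ⊕ # 2
potential RBB Sʳ Sʳ Iᵇ = 𝐀
potential RBB Sʳ Sʳ Dᵇ = 𝐀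
potential RBB Sʳ Iᵇ Dᵇ = 𝐀 ⊕ # 1
potential RBB Sʳ Dᵇ Iᵇ = 𝐀 ⊕ # 1
potential RBB Sʳ Dᵇ Dᵇ = 3 · 𝐀 ⊕ # 1
potential RBB Sʳ Iᵇ Sʳ = 2 · 𝐀 ⊕ # 1
potential RBB Sʳ Iᵇ Iᵇ = 3 · 𝐀 ⊕ # 1
potential RBB Sʳ Dᵇ Sʳ = 2 · 𝐀 ⊕ # 1
potential RBB Iᵇ Iᵇ Sʳ = 𝐀
potential RBB Iᵇ Iᵇ Dᵇ = 2 · 𝐀
potential RBB Iᵇ Sʳ Dᵇ = 2 · 𝐀 ⊕ # 1
potential RBB Iᵇ Sʳ Sʳ = 3 · 𝐀 ⊕ # 1
potential RBB Iᵇ Sʳ Iᵇ = 4 · 𝐀 ⊕ # 1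
potential RBB Iᵇ Dᵇ Iᵇ = 4 · 𝐀 ⊕ # 2
potential RBB Iᵇ Dᵇ Dᵇ = 6 · 𝐀 ⊕ # 2
potential RBB Iᵇ Dᵇ Sʳ = 5 · 𝐀 ⊕ # 2
potential RBB Dᵇ Dᵇ Sʳ = 𝐀
potential RBB Dᵇ Dᵇ Iᵇ = 2 · 𝐀
potential RBB Dᵇ Sʳ Iᵇ = 2 · 𝐀 ⊕ # 1
potential RBB Dᵇ Sʳ Dᵇ = 4 · 𝐀 ⊕ # 1
potential RBB Dᵇ Iᵇ Dᵇ = 4 · 𝐀 ⊕ # 2
potential RBB Dᵇ Sʳ Sʳ = 3 · 𝐀 ⊕ # 1
potential RBB Dᵇ Iᵇ Sʳ = 5 · 𝐀 ⊕ # 2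
potential RBB Dᵇ Iᵇ Iᵇ = 6 · 𝐀 ⊕ # 2
potential RBR Sʳ Sʳ Iᵇ = 𝐀
potential RBR Sʳ Sʳ Dʳ = 2 · 𝐀
potential RBR Sʳ Iᵇ Dʳ = 2 · 𝐀 ⊕ # 1
potential RBR Sʳ Iᵇ Sʳ = 4 · 𝐀 ⊕ # 1
potential RBR Sʳ Iᵇ Iᵇ = 3 · 𝐀 ⊕ # 1
potential RBR Sʳ Dʳ Sʳ = 4 · 𝐀 ⊕ # 2
potential RBR Sʳ Dʳ Iᵇ = 5 · 𝐀 ⊕ # 2
potential RBR Sʳ Dʳ Dʳ = 6 · 𝐀 ⊕ # 2
potential RBR Iᵇ Iᵇ Sʳ = 𝐀
potential RBR Iᵇ Iᵇ Dʳ = 𝐀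
potential RBR Iᵇ Dʳ Sʳ = 𝐀 ⊕ # 1
potential RBR Iᵇ Dʳ Iᵇ = 2 · 𝐀 ⊕ # 1
potential RBR Iᵇ Dʳ Dʳ = 3 · 𝐀 ⊕ # 1
potential RBR Iᵇ Sʳ Dʳ = 𝐀 ⊕ # 1
potential RBR Iᵇ Sʳ Sʳ = 3 · 𝐀 ⊕ # 1
potential RBR Iᵇ Sʳ Iᵇ = 2 · 𝐀 ⊕ # 1
potential RBR Dʳ Dʳ Sʳ = 2 · 𝐀
potential RBR Dʳ Dʳ Iᵇ = 𝐀
potential RBR Dʳ Iᵇ Sʳ = 2 · 𝐀 ⊕ # 1
potential RBR Dʳ Iᵇ Iᵇ = 3 · 𝐀 ⊕ # 1
potential RBR Dʳ Iᵇ Dʳ = 4 · 𝐀 ⊕ # 1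
potential RBR Dʳ Sʳ Dʳ = 4 · 𝐀 ⊕ # 2
potential RBR Dʳ Sʳ Sʳ = 6 · 𝐀 ⊕ # 2
potential RBR Dʳ Sʳ Iᵇ = 5 · 𝐀 ⊕ # 2
potential RRB Sʳ Sʳ Iʳ = 2 · 𝐀
potential RRB Sʳ Sʳ Dᵇ = 𝐀
potential RRB Sʳ Dᵇ Iʳ = 2 · 𝐀 ⊕ # 1
potential RRB Sʳ Dᵇ Dᵇ = 3 · 𝐀 ⊕ # 1
potential RRB Sʳ Dᵇ Sʳ = 4 · 𝐀 ⊕ # 1
potential RRB Sʳ Iʳ Sʳ = 4 · 𝐀 ⊕ # 2
potential RRB Sʳ Iʳ Iʳ = 6 · 𝐀 ⊕ # 2
potential RRB Sʳ Iʳ Dᵇ = 5 · 𝐀 ⊕ # 2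
potential RRB Iʳ Iʳ Sʳ = 2 · 𝐀
potential RRB Iʳ Iʳ Dᵇ = 𝐀
potential RRB Iʳ Dᵇ Sʳ = 2 · 𝐀 ⊕ # 1
potential RRB Iʳ Dᵇ Iʳ = 4 · 𝐀 ⊕ # 1
potential RRB Iʳ Dᵇ Dᵇ = 3 · 𝐀 ⊕ # 1
potential RRB Iʳ Sʳ Iʳ = 4 · 𝐀 ⊕ # 2
potential RRB Iʳ Sʳ Dᵇ = 5 · 𝐀 ⊕ # 2
potential RRB Iʳ Sʳ Sʳ = 6 · 𝐀 ⊕ # 2
potential RRB Dᵇ Dᵇ Sʳ = 𝐀
potential RRB Dᵇ Dᵇ Iʳ = 𝐀
potential RRB Dᵇ Sʳ Iʳ = 𝐀 ⊕ # 1
potential RRB Dᵇ Sʳ Dᵇ = 2 · 𝐀 ⊕ # 1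
potential RRB Dᵇ Iʳ Sʳ = 𝐀 ⊕ # 1
potential RRB Dᵇ Iʳ Iʳ = 3 · 𝐀 ⊕ # 1
potential RRB Dᵇ Iʳ Dᵇ = 2 · 𝐀 ⊕ # 1
potential RRB Dᵇ Sʳ Sʳ = 3 · 𝐀 ⊕ # 1
potential BRB Sᵇ Sᵇ Iʳ = 𝐀
potential BRB Sᵇ Sᵇ Dᵇ = 2 · 𝐀
potential BRB Sᵇ Iʳ Dᵇ = 2 · 𝐀 ⊕ # 1
potential BRB Sᵇ Iʳ Sᵇ = 4 · 𝐀 ⊕ # 1
potential BRB Sᵇ Iʳ Iʳ = 3 · 𝐀 ⊕ # 1
potential BRB Sᵇ Dᵇ Sᵇ = 4 · 𝐀 ⊕ # 2
potential BRB Sᵇ Dᵇ Iʳ = 5 · 𝐀 ⊕ # 2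
potential BRB Sᵇ Dᵇ Dᵇ = 6 · 𝐀 ⊕ # 2
potential BRB Iʳ Iʳ Sᵇ = 𝐀
potential BRB Iʳ Iʳ Dᵇ = 𝐀
potential BRB Iʳ Dᵇ Sᵇ = 𝐀 ⊕ # 1
potential BRB Iʳ Dᵇ Iʳ = 2 · 𝐀 ⊕ # 1
potential BRB Iʳ Dᵇ Dᵇ = 3 · 𝐀 ⊕ # 1
potential BRB Iʳ Sᵇ Dᵇ = 𝐀 ⊕ # 1
potential BRB Iʳ Sᵇ Sᵇ = 3 · 𝐀 ⊕ # 1
potential BRB Iʳ Sᵇ Iʳ = 2 · 𝐀 ⊕ # 1
potential BRB Dᵇ Dᵇ Sᵇ = 2 · 𝐀
potential BRB Dᵇ Dᵇ Iʳ = 𝐀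
potential BRB Dᵇ Iʳ Sᵇ = 2 · 𝐀 ⊕ # 1
potential BRB Dᵇ Iʳ Iʳ = 3 · 𝐀 ⊕ # 1
potential BRB Dᵇ Iʳ Dᵇ = 4 · 𝐀 ⊕ # 1
potential BRB Dᵇ Sᵇ Dᵇ = 4 · 𝐀 ⊕ # 2
potential BRB Dᵇ Sᵇ Sᵇ = 6 · 𝐀 ⊕ # 2
potential BRB Dᵇ Sᵇ Iʳ = 5 · 𝐀 ⊕ # 2
potential _ _ _ _ = # 0

-- Moves of n + 1 disks between states (x , y): the largest disk at x, the
-- others stacked at y. The side conditions are decided instances, so the
-- routes below need no explicit proofs.
data Step (κ : Scheme) : Pos × Pos → Pos × Pos → Set where
  small : ∀ {x y} y′ {_ : True (fits? ⟦ κ ⟧ x)} {_ : True (fits? ⟦ κ ▸ x ⟧ y)} {_ : True (fits? ⟦ κ ▸ x ⟧ y′)}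
        → Step κ (x , y) (x , y′)
  large : ∀ {p c r c′} q {_ : False (q ≟ᵖ p)} {_ : False (r ≟ᵖ p)} {_ : False (q ≟ᵖ r)}
          {_ : True (fits? ⟦ κ ⟧ (q , flipC c))}
        → Step κ ((p , c) , (r , c′)) ((q , flipC c) , (r , c′))

step-cost : ∀ {κ u v} → Step κ u v → Form
step-cost {κ} (small {x} {y} y′) = cost (κ ▸ x) y y′
step-cost (large _)              = # 1

route-cost : ∀ {κ u v} → Star (Step κ) u v → Form
route-cost ε       = # 0
route-cost (s ◅ ρ) = step-cost s ⊕ route-cost ρ

route : ∀ κ a b → Maybe (Star (Step κ) (a , a) (b , b))
route RBN Sʳ Sʳ = just ε
route RBN Sʳ Iᵇ = just (small Dʳ ◅ large I ◅ small Iᵇ ◅ ε)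
route RBN Sʳ Dʳ = just (small Dᵇ ◅ large I ◅ small Sʳ ◅ large D ◅ small Dʳ ◅ ε)
route RBN Sʳ Dᵇ = just (small Iᵇ ◅ large D ◅ small Sʳ ◅ small Dᵇ ◅ ε)
route RBN Iᵇ Sʳ = just (small Dʳ ◅ large S ◅ small Sʳ ◅ ε)
route RBN Iᵇ Iᵇ = just ε
route RBN Iᵇ Dʳ = just (small Sʳ ◅ large D ◅ small Dʳ ◅ ε)
route RBN Iᵇ Dᵇ = just (small Dʳ ◅ large S ◅ small Iᵇ ◅ large D ◅ small Sʳ ◅ small Dᵇ ◅ ε)
route RBN Dʳ Sʳ = just (small Sʳ ◅ large I ◅ small Dᵇ ◅ large S ◅ small Sʳ ◅ ε)
route RBN Dʳ Iᵇ = just (small Sʳ ◅ large I ◅ small Iᵇ ◅ ε)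
route RBN Dʳ Dʳ = just ε
route RBN Dʳ Dᵇ = just (small Sʳ ◅ large I ◅ small Dʳ ◅ large S ◅ small Iᵇ ◅ large D ◅ small Sʳ ◅ small Dᵇ ◅ ε)
route RBN Dᵇ Sʳ = just (small Iᵇ ◅ large S ◅ small Sʳ ◅ ε)
route RBN Dᵇ Iᵇ = just (small Iᵇ ◅ large S ◅ small Dʳ ◅ large I ◅ small Iᵇ ◅ ε)
route RBN Dᵇ Dʳ = just (small Iᵇ ◅ large S ◅ small Dʳ ◅ large I ◅ small Sʳ ◅ large D ◅ small Dʳ ◅ ε)
route RBN Dᵇ Dᵇ = just ε
route NRB Sʳ Sʳ = just ε
route NRB Sʳ Sᵇ = just (small Iʳ ◅ large D ◅ small Sʳ ◅ large I ◅ small Dᵇ ◅ large S ◅ small Sᵇ ◅ ε)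
route NRB Sʳ Iʳ = just (small Iʳ ◅ large D ◅ small Sᵇ ◅ large I ◅ small Iʳ ◅ ε)
route NRB Sʳ Dᵇ = just (small Iʳ ◅ large D ◅ small Dᵇ ◅ ε)
route NRB Sᵇ Sʳ = just (small Dᵇ ◅ large I ◅ small Sʳ ◅ large D ◅ small Iʳ ◅ large S ◅ small Sʳ ◅ ε)
route NRB Sᵇ Sᵇ = just ε
route NRB Sᵇ Iʳ = just (small Dᵇ ◅ large I ◅ small Iʳ ◅ ε)
route NRB Sᵇ Dᵇ = just (small Dᵇ ◅ large I ◅ small Sʳ ◅ large D ◅ small Dᵇ ◅ ε)
route NRB Iʳ Sʳ = just (small Sᵇ ◅ large D ◅ small Iʳ ◅ large S ◅ small Sʳ ◅ ε)
route NRB Iʳ Sᵇ = just (small Dᵇ ◅ large S ◅ small Sᵇ ◅ ε)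
route NRB Iʳ Iʳ = just ε
route NRB Iʳ Dᵇ = just (small Sʳ ◅ large D ◅ small Dᵇ ◅ ε)
route NRB Dᵇ Sʳ = just (small Iʳ ◅ large S ◅ small Sʳ ◅ ε)
route NRB Dᵇ Sᵇ = just (small Sʳ ◅ large I ◅ small Dᵇ ◅ large S ◅ small Sᵇ ◅ ε)
route NRB Dᵇ Iʳ = just (small Sʳ ◅ large I ◅ small Iʳ ◅ ε)
route NRB Dᵇ Dᵇ = just ε
route RBB Sʳ Sʳ = just ε
route RBB Sʳ Iᵇ = just (small Dᵇ ◅ large I ◅ small Sʳ ◅ small Iᵇ ◅ ε)
route RBB Sʳ Dᵇ = just (small Iᵇ ◅ large D ◅ small Sʳ ◅ small Dᵇ ◅ ε)
route RBB Iᵇ Sʳ = just (small Sʳ ◅ small Dᵇ ◅ large S ◅ small Sʳ ◅ ε)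
route RBB Iᵇ Iᵇ = just ε
route RBB Iᵇ Dᵇ = just (small Sʳ ◅ small Dᵇ ◅ large S ◅ small Iᵇ ◅ large D ◅ small Sʳ ◅ small Dᵇ ◅ ε)
route RBB Dᵇ Sʳ = just (small Iᵇ ◅ large S ◅ small Sʳ ◅ ε)
route RBB Dᵇ Iᵇ = just (small Iᵇ ◅ large S ◅ small Sʳ ◅ small Dᵇ ◅ large I ◅ small Sʳ ◅ small Iᵇ ◅ ε)
route RBB Dᵇ Dᵇ = just ε
route RBR Sʳ Sʳ = just ε
route RBR Sʳ Iᵇ = just (small Dʳ ◅ large I ◅ small Iᵇ ◅ ε)
route RBR Sʳ Dʳ = just (small Dʳ ◅ large I ◅ small Sʳ ◅ large D ◅ small Dʳ ◅ ε)
route RBR Iᵇ Sʳ = just (small Dʳ ◅ large S ◅ small Sʳ ◅ ε)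
route RBR Iᵇ Iᵇ = just ε
route RBR Iᵇ Dʳ = just (small Sʳ ◅ large D ◅ small Dʳ ◅ ε)
route RBR Dʳ Sʳ = just (small Sʳ ◅ large I ◅ small Dʳ ◅ large S ◅ small Sʳ ◅ ε)
route RBR Dʳ Iᵇ = just (small Sʳ ◅ large I ◅ small Iᵇ ◅ ε)
route RBR Dʳ Dʳ = just ε
route RRB Sʳ Sʳ = just ε
route RRB Sʳ Iʳ = just (small Iʳ ◅ large D ◅ small Sʳ ◅ large I ◅ small Iʳ ◅ ε)
route RRB Sʳ Dᵇ = just (small Iʳ ◅ large D ◅ small Dᵇ ◅ ε)
route RRB Iʳ Sʳ = just (small Sʳ ◅ large D ◅ small Iʳ ◅ large S ◅ small Sʳ ◅ ε)
route RRB Iʳ Iʳ = just ε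
route RRB Iʳ Dᵇ = just (small Sʳ ◅ large D ◅ small Dᵇ ◅ ε)
route RRB Dᵇ Sʳ = just (small Iʳ ◅ large S ◅ small Sʳ ◅ ε)
route RRB Dᵇ Iʳ = just (small Sʳ ◅ large I ◅ small Iʳ ◅ ε)
route RRB Dᵇ Dᵇ = just ε
route BRB Sᵇ Sᵇ = just ε
route BRB Sᵇ Iʳ = just (small Dᵇ ◅ large I ◅ small Iʳ ◅ ε)
route BRB Sᵇ Dᵇ = just (small Dᵇ ◅ large I ◅ small Sᵇ ◅ large D ◅ small Dᵇ ◅ ε)
route BRB Iʳ Sᵇ = just (small Dᵇ ◅ large S ◅ small Sᵇ ◅ ε)
route BRB Iʳ Iʳ = just ε
route BRB Iʳ Dᵇ = just (small Sᵇ ◅ large D ◅ small Dᵇ ◅ ε)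
route BRB Dᵇ Sᵇ = just (small Sᵇ ◅ large I ◅ small Dᵇ ◅ large S ◅ small Sᵇ ◅ ε)
route BRB Dᵇ Iʳ = just (small Sᵇ ◅ large I ◅ small Iʳ ◅ ε)
route BRB Dᵇ Dᵇ = just ε
route _ _ _ = nothing

infix 4 _≼?_
_≼?_ : ∀ f g → Dec (f ≼ g)
f ≼? g = map′ certified _≼_.certificate (T? (entails 2 f g))

▸-agrees : ∀ κ x → Fits ⟦ κ ⟧ x → ∀ q → ⟦ κ ▸ x ⟧ q ≡ above ⟦ κ ⟧ x q
▸-agrees = from-yes (all? λ κ → all? λ x → fits? ⟦ κ ⟧ x →-dec
  all? λ q → ≡-dec-Maybe _≟ᶜ_ (⟦ κ ▸ x ⟧ q) (above ⟦ κ ⟧ x q))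

potential-small : ∀ κ b x y y′ → Fits ⟦ κ ⟧ b → Fits ⟦ κ ⟧ x → Fits ⟦ κ ▸ x ⟧ y → Fits ⟦ κ ▸ x ⟧ y′
                → potential κ b x y ≼ cost (κ ▸ x) y y′ ⊕ potential κ b x y′
potential-small = from-yes (all? λ κ → all? λ b → all? λ x → all? λ y → all? λ y′ →
  fits? ⟦ κ ⟧ b →-dec fits? ⟦ κ ⟧ x →-dec fits? ⟦ κ ▸ x ⟧ y →-dec fits? ⟦ κ ▸ x ⟧ y′ →-dec
  potential κ b x y ≼? cost (κ ▸ x) y y′ ⊕ potential κ b x y′)

potential-large : ∀ κ b p c q c′ → Fits ⟦ κ ⟧ b → Fits ⟦ κ ⟧ (p , c) → q ≢ p
                → Fits ⟦ κ ▸ (p , c) ⟧ (third p q , c′) → Fits ⟦ κ ⟧ (q , flipC c)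
                → Fits ⟦ κ ▸ (q , flipC c) ⟧ (third p q , c′)
                × potential κ b (p , c) (third p q , c′) ≼ # 1 ⊕ potential κ b (q , flipC c) (third p q , c′)
potential-large = from-yes (all? λ κ → all? λ b → all? λ p → all? λ c → all? λ q → all? λ c′ →
  fits? ⟦ κ ⟧ b →-dec fits? ⟦ κ ⟧ (p , c) →-dec ¬? (q ≟ᵖ p) →-dec
  fits? ⟦ κ ▸ (p , c) ⟧ (third p q , c′) →-dec fits? ⟦ κ ⟧ (q , flipC c) →-dec
  fits? ⟦ κ ▸ (q , flipC c) ⟧ (third p q , c′)
  ×-dec potential κ b (p , c) (third p q , c′) ≼? # 1 ⊕ potential κ b (q , flipC c) (third p q , c′))

potential-target : ∀ κ b → Fits ⟦ κ ⟧ b → Fits ⟦ κ ▸ b ⟧ b × potential κ b b b ≼ # 0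
potential-target = from-yes (all? λ κ → all? λ b → fits? ⟦ κ ⟧ b →-dec
  fits? ⟦ κ ▸ b ⟧ b ×-dec potential κ b b b ≼? # 0)

cost-potential : ∀ κ a b → Fits ⟦ κ ⟧ a → Fits ⟦ κ ⟧ b
               → Fits ⟦ κ ▸ a ⟧ a × pull (cost κ a b) ≼ potential κ b a a
cost-potential = from-yes (all? λ κ → all? λ a → all? λ b → fits? ⟦ κ ⟧ a →-dec fits? ⟦ κ ⟧ b →-dec
  fits? ⟦ κ ▸ a ⟧ a ×-dec pull (cost κ a b) ≼? potential κ b a a)

cost-zero : ∀ κ a b → eval (cost κ a b) (basis 0) ≡ 0
cost-zero = from-yes (all? λ κ → all? λ a → all? λ b → eval (cost κ a b) (basis 0) ≟ 0)

route-optimal : ∀ κ a b → Fits ⟦ κ ⟧ a → Fits ⟦ κ ⟧ b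
              → OnJust (λ ρ → route-cost ρ ≼ pull (cost κ a b)) (route κ a b)
route-optimal = from-yes (all? λ κ → all? λ a → all? λ b → fits? ⟦ κ ⟧ a →-dec fits? ⟦ κ ⟧ b →-dec
  MaybeAny.dec (λ ρ → route-cost ρ ≼? pull (cost κ a b)) (route κ a b))

-- The induction

LowerBound : ℕ → Set
LowerBound n = ∀ κ a b → Fits ⟦ κ ⟧ a → Fits ⟦ κ ⟧ b →
  ∀ {k} → Reach ⟦ κ ⟧ k (Tower n a) (Tower n b) → eval (cost κ a b) (basis n) ≤ k

UpperBound : ℕ → Set
UpperBound n = ∀ κ a b → Fits ⟦ κ ⟧ a → Fits ⟦ κ ⟧ b →
  Σ ℕ λ k → k ≤ eval (cost κ a b) (basis n) × Reach ⟦ κ ⟧ k (Tower n a) (Tower n b)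

lower-zero : LowerBound 0
lower-zero κ a b _ _ {k} _ = subst (_≤ k) (sym (cost-zero κ a b)) z≤n

-- The potential argument: follow a play until its first move of the
-- largest disk, charging the moves of the smaller disks made so far.
module Potential {n} (lower : LowerBound n) (κ : Scheme) (b : Pos) (fit-b : Fits ⟦ κ ⟧ b) where
  open ≤-Reasoning

  φ : Pos → Pos → ℕ
  φ x y = eval (potential κ b x y) (basis n)

  φ-small : ∀ {x y y′ k} → Fits ⟦ κ ⟧ x → Fits ⟦ κ ▸ x ⟧ y → Fits ⟦ κ ▸ x ⟧ y′
          → Reach ⟦ κ ▸ x ⟧ k (Tower n y) (Tower n y′) → φ x y ≤ k + φ x y′
  φ-small {x} {y} {y′} {k} fit-x fit-y fit-y′ r = begin
    φ x y                                          ≤⟨ ≼-sound (potential-small κ b x y y′ fit-b fit-x fit-y fit-y′) n ⟩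
    eval (cost (κ ▸ x) y y′ ⊕ potential κ b x y′) (basis n)
                                                   ≡⟨ eval-⊕ (cost (κ ▸ x) y y′) (potential κ b x y′) (basis n) ⟩
    eval (cost (κ ▸ x) y y′) (basis n) + φ x y′    ≤⟨ +-monoˡ-≤ (φ x y′) (lower (κ ▸ x) y y′ fit-y fit-y′ r) ⟩
    k + φ x y′                                     ∎

  -- The smaller disks went from a tower at y to xs in k₀ moves, and the
  -- play continues from xs ∷ʳ x to the target in k₁ moves.
  φ-bound : ∀ {k₀ k₁ s} x y (xs : State n) → s ≡ xs ∷ʳ x → Reach ⟦ κ ⟧ k₁ s (Tower n b ∷ʳ b)
          → Fits ⟦ κ ⟧ x → Fits ⟦ κ ▸ x ⟧ y → Reach ⟦ κ ▸ x ⟧ k₀ (Tower n y) xs → φ x y ≤ k₀ + k₁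
  φ-bound {k₀} x y xs eq done fit-x fit-y r₀ with ∷ʳ-injective (Tower n b) xs eq
  ... | refl , refl = begin
    φ b y        ≤⟨ φ-small fit-x fit-y (proj₁ (potential-target κ b fit-b)) r₀ ⟩
    k₀ + φ b b   ≤⟨ +-monoʳ-≤ k₀ (≼-sound (proj₂ (potential-target κ b fit-b)) n) ⟩
    k₀ + 0       ∎
  φ-bound {k₀} x y xs refl (step {k₁} m w) fit-x fit-y r₀ with moveView m
  ... | small {ys = ys} m′ = begin
    φ x y          ≤⟨ φ-bound x y ys refl w fit-x fit-y (r₀ ▷ move-cong (sym ∘ ▸-agrees κ x fit-x) m′) ⟩
    suc k₀ + k₁    ≡⟨ sym (+-suc k₀ k₁) ⟩
    k₀ + suc k₁    ∎
  ... | large {p} {c} q q≢p off-p off-q fit-q = begin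
    φ x y                                 ≤⟨ φ-small fit-x fit-y fit-r (subst (Reach _ k₀ (Tower n y)) xs≡tower r₀) ⟩
    k₀ + φ x (r , c′)                     ≤⟨ +-monoʳ-≤ k₀ (≼-sound (proj₂ large-ok) n) ⟩
    k₀ + eval (# 1 ⊕ potential κ b x′ (r , c′)) (basis n)
                                          ≡⟨ cong (k₀ +_) (eval-⊕ (# 1) (potential κ b x′ (r , c′)) (basis n)) ⟩
    k₀ + suc (φ x′ (r , c′))              ≤⟨ +-monoʳ-≤ k₀ (s≤s rest) ⟩
    k₀ + suc k₁                           ∎
    where
      r : Post
      r = third p q
      x′ : Pos
      x′ = q , flipC c
      on-r : ∀ i → postOf xs i ≡ r
      on-r i = third-unique p q (postOf xs i) (q≢p ∘ sym) (off-p i) (off-q i)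
      tower : Σ Color λ c′ → Fits ⟦ κ ▸ x ⟧ (r , c′) × xs ≡ Tower n (r , c′)
      tower = one-post⇒tower {pc = ⟦ κ ▸ x ⟧} xs r on-r (reach-monochrome r₀ (tower-monochrome n y))
                (reach-respects r₀ (tower-respects {⟦ κ ▸ x ⟧} n y fit-y))
      c′ : Color
      c′ = proj₁ tower
      fit-r : Fits ⟦ κ ▸ x ⟧ (r , c′)
      fit-r = proj₁ (proj₂ tower)
      xs≡tower : xs ≡ Tower n (r , c′)
      xs≡tower = proj₂ (proj₂ tower)
      large-ok : Fits ⟦ κ ▸ x′ ⟧ (r , c′) × potential κ b x (r , c′) ≼ # 1 ⊕ potential κ b x′ (r , c′)
      large-ok = potential-large κ b p c q c′ fit-b fit-x q≢p fit-r fit-q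
      rest : φ x′ (r , c′) ≤ k₁
      rest = φ-bound x′ (r , c′) (Tower n (r , c′)) (cong (_∷ʳ x′) xs≡tower) w fit-q (proj₁ large-ok) done

lower-suc : ∀ {n} → LowerBound n → LowerBound (suc n)
lower-suc {n} lower κ a b fit-a fit-b {k} r = begin
  eval (cost κ a b) (basis (suc n))   ≡⟨ eval-pull (cost κ a b) (basis n) ⟩
  eval (pull (cost κ a b)) (basis n)  ≤⟨ ≼-sound (proj₂ initial) n ⟩
  φ a a                               ≤⟨ φ-bound a a (Tower n a) (replicate-suc-∷ʳ n a)
                                           (subst (Reach ⟦ κ ⟧ k _) (replicate-suc-∷ʳ n b) r) fit-a (proj₁ initial) done ⟩
  k                                   ∎
  where
    open Potential lower κ b fit-b
    open ≤-Reasoning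
    initial : Fits ⟦ κ ▸ a ⟧ a × pull (cost κ a b) ≼ potential κ b a a
    initial = cost-potential κ a b fit-a fit-b

lower-bound : ∀ n → LowerBound n
lower-bound zero    = lower-zero
lower-bound (suc n) = lower-suc (lower-bound n)

module Strategy {n} (upper : UpperBound n) (κ : Scheme) where

  state : Pos × Pos → State (suc n)
  state (x , y) = Tower n y ∷ʳ x

  play-step : ∀ {u v} (s : Step κ u v) →
    Σ ℕ λ k → k ≤ eval (step-cost s) (basis n) × Reach ⟦ κ ⟧ k (state u) (state v)
  play-step (small {x} {y} y′ {fit-x} {fit-y} {fit-y′}) =
    k , k≤ , lift-reach (toWitness fit-x) (reach-cong (▸-agrees κ x (toWitness fit-x)) r)
    where
      played = upper (κ ▸ x) y y′ (toWitness fit-y) (toWitness fit-y′)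
      k = proj₁ played
      k≤ = proj₁ (proj₂ played)
      r = proj₂ (proj₂ played)
  play-step (large {p} {c} {r} {c′} q {q≢p} {r≢p} {q≢r} {fit-q}) =
    1 , ≤-refl , step (large-move q (toWitnessFalse q≢p) (λ i → toWitnessFalse r≢p ∘ trans (on-r i))
                                   (λ i e → toWitnessFalse q≢r (sym (trans (on-r i) e)))
                                   (toWitness fit-q)) done
    where
      on-r : ∀ i → r ≡ postOf (Tower n (r , c′)) i
      on-r i = sym (cong proj₁ (lookup-replicate i (r , c′)))

  play : ∀ {u v} (ρ : Star (Step κ) u v) →
    Σ ℕ λ k → k ≤ eval (route-cost ρ) (basis n) × Reach ⟦ κ ⟧ k (state u) (state v)
  play ε       = 0 , z≤n , done
  play (s ◅ ρ) with play-step s | play ρ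
  ... | k , k≤ , r | l , l≤ , r′ =
    k + l , subst (k + l ≤_) (sym (eval-⊕ (step-cost s) (route-cost ρ) (basis n))) (+-mono-≤ k≤ l≤) , r ++ᴿ r′

upper-suc : ∀ {n} → UpperBound n → UpperBound (suc n)
upper-suc {n} upper κ a b fit-a fit-b = follow (route-optimal κ a b fit-a fit-b)
  where
    goal : ℕ → Set
    goal k = k ≤ eval (cost κ a b) (basis (suc n)) × Reach ⟦ κ ⟧ k (Tower (suc n) a) (Tower (suc n) b)
    follow : ∀ {m} → OnJust (λ ρ → route-cost ρ ≼ pull (cost κ a b)) m → Σ ℕ goal
    follow (just {ρ} ρ≼) with Strategy.play upper κ ρ
    ... | k , k≤ , r =
      k , ≤-trans k≤ (subst (eval (route-cost ρ) (basis n) ≤_) (sym (eval-pull (cost κ a b) (basis n))) (≼-sound ρ≼ n)) ,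
      subst₂ (Reach ⟦ κ ⟧ k) (sym (replicate-suc-∷ʳ n a)) (sym (replicate-suc-∷ʳ n b)) r

upper-bound : ∀ n → UpperBound n
upper-bound zero    κ a b _ _ = 0 , z≤n , done
upper-bound (suc n) = upper-suc (upper-bound n)

min-moves : ∀ κ N → Fits ⟦ κ ⟧ Sʳ → Fits ⟦ κ ⟧ Dᵇ → MinMoves ⟦ κ ⟧ N (eval (cost κ Sʳ Dᵇ) (basis N))
min-moves κ N fit-a fit-b with upper-bound N κ Sʳ Dᵇ fit-a fit-b
... | k , k≤ , r =
  subst (λ m → Reach ⟦ κ ⟧ m _ _) (≤-antisym k≤ (lower r)) r , λ _ r′ → lower r′
  where
    lower : ∀ {k} → Reach ⟦ κ ⟧ k (Tower N Sʳ) (Tower N Dᵇ) → eval (cost κ Sʳ Dᵇ) (basis N) ≤ k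
    lower = lower-bound N κ Sʳ Dᵇ fit-a fit-b

3^n≡1+2A : ∀ n → 3 ^ n ≡ 1 + 2 * Basis.bA (basis n)
3^n≡1+2A zero    = refl
3^n≡1+2A (suc n) rewrite 3^n≡1+2A n = lemma (Basis.bA (basis n))
  where
    lemma : ∀ a → 3 * (1 + 2 * a) ≡ 1 + 2 * (3 * a + 1)
    lemma = solve-∀

S1000≡A : ∀ n → S1000 n ≡ Basis.bA (basis n)
S1000≡A n rewrite 3^n≡1+2A n = trans (cong (_/ 2) (*-comm 2 (Basis.bA (basis n)))) (m*n/n≡m _ 2)

mutual
  S909≡R : ∀ n → S909 n ≡ Basis.bR (basis n)
  S909≡R zero          = refl
  S909≡R (suc zero)    = refl
  S909≡R (suc (suc n)) =
    trans (cong₂ (λ p a → p + 2 * a + 1) (S727≡P (suc n)) (S1000≡A (suc n)))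
          (lemma (Basis.bP (basis (suc n))) (Basis.bA (basis (suc n))))
    where
      lemma : ∀ p a → p + 2 * a + 1 ≡ 2 * a + p + 1
      lemma = solve-∀

  S727≡P : ∀ n → S727 n ≡ Basis.bP (basis n)
  S727≡P zero                = refl
  S727≡P (suc zero)          = refl
  S727≡P (suc (suc zero))    = refl
  S727≡P (suc (suc (suc n))) =
    trans (cong₂ (λ r₂ r₁ → r₂ + 2 * r₁ + 2 * S1000 (suc n) + 3) (S909≡R (suc (suc n))) (S909≡R (suc n)))
      (trans (cong (λ a → R₂ + 2 * R₁ + 2 * a + 3) (S1000≡A (suc n))) (lemma R₂ R₁ (Basis.bA (basis (suc n)))))
    where
      R₂ R₁ : ℕ
      R₂ = Basis.bR (basis (suc (suc n)))
      R₁ = Basis.bR (basis (suc n))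
      lemma : ∀ r₂ r₁ a → r₂ + 2 * r₁ + 2 * a + 3 ≡ (2 * a + 2 * r₁ + 2) + r₂ + 1
      lemma = solve-∀

eval-𝐑 : ∀ β → eval 𝐑 β ≡ Basis.bR β
eval-𝐑 basis⟨ A , P , Q , R , T ⟩ = lemma A P Q R T
  where
    lemma : ∀ A P Q R T → 0 * A + 0 * P + 0 * Q + 1 * R + 0 * T + 0 ≡ R
    lemma = solve-∀

mainTheorem2 : (N : ℕ) → N ≥ 1 →
    MinMoves colRBN N (S909 N) × MinMoves colNRB N (S909 N)
mainTheorem2 N _ =
    subst (MinMoves colRBN N) S909-value
      (min-moves RBN N (from-yes (fits? colRBN Sʳ)) (from-yes (fits? colRBN Dᵇ)))
  , subst (MinMoves colNRB N) S909-value
      (min-moves NRB N (from-yes (fits? colNRB Sʳ)) (from-yes (fits? colNRB Dᵇ)))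
  where
    S909-value : eval 𝐑 (basis N) ≡ S909 N
    S909-value = trans (eval-𝐑 (basis N)) (sym (S909≡R N))
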